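{- Let $\Lambda=(B,K,\Theta)$ be a signature with parameter set $A$, let $(H,\diamond)$ be a head type and let $V$ be an $A$-family of bottomed sets. Then there exists a $V$-minimal regular $(H,\diamond)$-algebra. Moreover, any such $(H,\diamond)$-algebra $(X,p)$ is an initial object among $(H,\diamond)$-algebras bound to $V$: for every $(H,\diamond)$-algebra $(Y,q)$ bound to $V$ there is exactly one bottomed homomorphism $(X,p)\to(Y,q)$ fixing $V$.
   Context: A signature is a triple $\Lambda=(B,K,\Theta)$ with $B,K$ non-empty sets and $\Theta$ assigning to each $k\in K$ a pair $(\underline{k},\overline{k})$, $\overline{k}\in B$, $\underline{k}:D_k\to B$ with $D_k$ finite. $K_b=\{k:\overline{k}=b\}$; parameter set $A=\{b:K_b=\emptyset\}$. For a $B$-family of sets $X$ and $\gamma:I\to B$ ($I$ finite), $[X]_\gamma$ is the set of maps $v$ on $I$ with $v(\eta)\in X_{\gamma(\eta)}$; for maps $\pi_b:X_b\to Y_b$, $[\pi]_\gamma(v)(\eta)=\pi_{\gamma(\eta)}(v(\eta))$. A bottomed set is a set with a distinguished element $\bot$; a map $f$ of bottomed sets is bottomed if $f(\bot)=\bot$, proper if bottomed and $f(x)\ne\bot$ for $x\ne\bot$. A bottomed $\Lambda$-algebra is $(X,p)$ with $X$ a $B$-family of bottomed sets (bottoms $\bot_b$) and arbitrary maps $p_k:[X]_{\underline{k}}\to X_{\overline{k}}$. A bottomed homomorphism $\pi:(X,p)\to(Y,q)$ is a family of bottomed maps $\pi_b$ with $q_k\circ[\pi]_{\underline{k}}=\pi_{\overline{k}}\circ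 p_k$ for all $k$. $(X,p)$ is bound to $V$ if $X_a=V_a$ for all $a\in A$; a homomorphism fixes $V$ if $\pi_a$ is the identity for $a\in A$. A family $Z\subseteq X$ is invariant if $p_k([Z]_{\underline{k}})\subseteq Z_{\overline{k}}$ for all $k$, bottomed if $\bot_b\in Z_b$; $(X,p)$ is $V$-minimal if bound to $V$ and $X$ is the only invariant bottomed family $Z$ with $Z_a=V_a$ for $a\in A$. $(X,p)$ is regular if for each $b\in B\setminus A$ and $x\in X_b\setminus\{\bot_b\}$ there are a unique $k\in K_b$ and unique $v\in[X]_{\underline{k}}$ with $p_k(v)=x$. Let $\mathbb{T}=\{\bot,\natural\}$ be a two-element bottomed set with bottom $\bot$. A head type is a bottomed $\Lambda$-algebra $(H,\diamond)$ with $H_a=\mathbb{T}$ for all $a\in A$. A bottomed $\Lambda$-algebra is an $(H,\diamond)$-algebra if there is a bottomed homomorphism from it to $(H,\diamond)$ all of whose components are proper. -}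

module Defs where

open import Level using (0ℓ)
open import Data.Nat using (ℕ)
open import Data.Fin using (Fin)
open import Data.Product using (Σ; _×_; _,_; ∃)
open import Data.Empty using (⊥)
open import Relation.Nullary using (¬_)
open import Relation.Binary.PropositionalEquality using (_≡_; _≢_; subst)
open import Function.Bundles using (_↔_)

record BSet : Set₁ where
  constructor mkBSet
  field
    Car : Set
    bot : Car
open BSet public

Bottomed : (S T : BSet) → (Car S → Car T) → Set
Bottomed S T f = f (bot S) ≡ bot T

Proper : (S T : BSet) → (Car S → Car T) → Set
Proper S T f = Bottomed S T f × (∀ x → x ≢ bot S → f x ≢ bot T)

cast : {S T : BSet} → S ≡ T → Car S → Car T
cast e = subst Car e

data 𝕋₀ : Set where
  ⊥𝕋 ♮ : 𝕋₀

𝕋 : BSet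
𝕋 = mkBSet 𝕋₀ ⊥𝕋

Finite : Set → Set
Finite D = Σ ℕ (λ n → D ↔ Fin n)

record Signature : Set₁ where
  field
    B     : Set
    K     : Set
    b₀    : B
    k₀    : K
    D     : K → Set
    D-fin : ∀ k → Finite (D k)
    under : (k : K) → D k → B
    over  : K → B

module _ (Λ : Signature) where
  open Signature Λ

  -- b ∈ A  iff  K_b = ∅
  IsParam : B → Set
  IsParam b = ¬ (Σ K (λ k → over k ≡ b))

  ParamFamily : Set₁
  ParamFamily = (b : B) → .(IsParam b) → BSet

  Args : (B → BSet) → K → Set
  Args X k = (d : D k) → Car (X (under k d))

  mapArgs : {X Y : B → BSet} → ((b : B) → Car (X b) → Car (Y b)) →
            (k : K) → Args X k → Args Y k
  mapArgs π k v d = π (under k d) (v d)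

  record Alg : Set₁ where
    field
      car : B → BSet
      op  : (k : K) → Args car k → Car (car (over k))
  open Alg public

  ⊥ₐ : (X : Alg) (b : B) → Car (car X b)
  ⊥ₐ X b = bot (car X b)

  record Hom (X Y : Alg) : Set where
    field
      map      : (b : B) → Car (car X b) → Car (car Y b)
      bottomed : ∀ b → Bottomed (car X b) (car Y b) (map b)
      commutes : ∀ k (v : Args (car X) k) →
                 op Y k (mapArgs {car X} {car Y} map k v) ≡ map (over k) (op X k v)
  open Hom public

  BoundTo : ParamFamily → Alg → Set₁
  BoundTo V X = (b : B) (pa : IsParam b) → car X b ≡ V b pa

  Fixes : (V : ParamFamily) (X Y : Alg) → BoundTo V X → BoundTo V Y →
          Hom X Y → Set
  Fixes V X Y bX bY π =
    ∀ b (pa : IsParam b) (x : Car (car X b)) →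
      cast {car Y b} {V b pa} (bY b pa) (map π b x) ≡ cast {car X b} {V b pa} (bX b pa) x

  Invariant : (X : Alg) → ((b : B) → Car (car X b) → Set) → Set
  Invariant X Z = ∀ k (v : Args (car X) k) →
                  (∀ d → Z (under k d) (v d)) → Z (over k) (op X k v)

  BottomedFam : (X : Alg) → ((b : B) → Car (car X b) → Set) → Set
  BottomedFam X Z = ∀ b → Z b (⊥ₐ X b)

  -- V-minimality (the "bound to V" part is carried separately)
  Minimal : Alg → Set₁
  Minimal X = (Z : (b : B) → Car (car X b) → Set) →
              Invariant X Z → BottomedFam X Z →
              (∀ a → IsParam a → ∀ x → Z a x) →
              ∀ b x → Z b x

  Regular : Alg → Set
  Regular X =
    (b : B) → ¬ IsParam b → (x : Car (car X b)) → x ≢ ⊥ₐ X b →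
    Σ K λ k → Σ (over k ≡ b) λ e → Σ (Args (car X) k) λ v →
      (subst (λ c → Car (car X c)) e (op X k v) ≡ x) ×
      (∀ k' (e' : over k' ≡ b) (v' : Args (car X) k') →
         subst (λ c → Car (car X c)) e' (op X k' v') ≡ x →
         Σ (k' ≡ k) λ eq → subst (Args (car X)) eq v' ≡ v)

  record HeadType : Set₁ where
    field
      alg  : Alg
      isHd : (b : B) → IsParam b → car alg b ≡ 𝕋
  open HeadType public

  IsHAlg : HeadType → Alg → Set
  IsHAlg H X = Σ (Hom X (alg H)) λ h →
               ∀ b → Proper (car X b) (car (alg H) b) (map h b)

-- Existence: terms over the operations with leaves in V, keeping only those whose value in the
-- head type is not bottom (an operation whose head would be bottom returns bottom).  The head
-- map is then proper, a non-bottom term is a unique node, and terms are inductively generated.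
-- Initiality: relate X to Y by the least relation containing the bottoms and X_a = V_a = Y_a and
-- closed under the operations.  Related elements have equal heads, since H_a = 𝕋 has only one
-- non-bottom element; hence bottoms are related only to bottoms, regularity of X lets the relation
-- be inverted at p_k(v), and minimality of X makes it the graph of the unique homomorphism.
module Submission where

open import Defs
open import Level using (0ℓ)
open import Data.Maybe using (Maybe; just; nothing)
open import Data.Maybe.Properties using (just-injective)
open import Data.Product using (Σ; ∃!; _×_; _,_; proj₁; proj₂)
open import Data.Product.Properties using (Σ-≡,≡←≡)
open import Function using (_∘_)
open import Relation.Nullary using (¬_; Dec; yes; no; contradiction)
open import Relation.Binary.PropositionalEquality
open import Axiom.ExcludedMiddle using (ExcludedMiddle)
open import Axiom.Extensionality.Propositional using (Extensionality)
open import Axiom.UniquenessOfIdentityProofs.WithK using (uip)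

∘-proper : {R S T : BSet} {f : Car S → Car T} {g : Car R → Car S} →
           Proper S T f → Proper R S g → Proper R T (f ∘ g)
∘-proper {f = f} (f⊥ , f-def) (g⊥ , g-def) =
  trans (cong f g⊥) f⊥ , λ x x≢⊥ → f-def _ (g-def x x≢⊥)

cast-proper : {S T : BSet} (e : S ≡ T) → Proper S T (cast e)
cast-proper refl = refl , λ _ x≢⊥ → x≢⊥

cast-transpose : {S S′ T : BSet} (e : S ≡ T) (e′ : S′ ≡ T) {x : Car S} {y : Car S′} →
                 cast e x ≡ cast e′ y → y ≡ cast (sym e′) (cast e x)
cast-transpose refl refl eq = sym eq

proper-reflects-bot : ExcludedMiddle 0ℓ → {S T : BSet} {f : Car S → Car T} →
                      Proper S T f → ∀ {x} → f x ≡ bot T → x ≡ bot S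
proper-reflects-bot em {S} (_ , f-def) {x} fx≡⊥ with em {x ≡ bot S}
... | yes x≡⊥ = x≡⊥
... | no x≢⊥ = contradiction fx≡⊥ (f-def x x≢⊥)

♮-unique : {u v : 𝕋₀} → u ≢ ⊥𝕋 → v ≢ ⊥𝕋 → u ≡ v
♮-unique {⊥𝕋} u≢⊥ _ = contradiction refl u≢⊥
♮-unique {♮} {⊥𝕋} _ v≢⊥ = contradiction refl v≢⊥
♮-unique {♮} {♮} _ _ = refl

proper-into-𝕋-unique : ExcludedMiddle 0ℓ → {S T : BSet} → T ≡ 𝕋 →
                       {f g : Car S → Car T} → Proper S T f → Proper S T g →
                       ∀ x → f x ≡ g x
proper-into-𝕋-unique em {S} refl (f⊥ , f-def) (g⊥ , g-def) x with em {x ≡ bot S}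
... | yes refl = trans f⊥ (sym g⊥)
... | no x≢⊥ = ♮-unique (f-def x x≢⊥) (g-def x x≢⊥)

collapse : ExcludedMiddle 0ℓ → (S : BSet) → Car S → 𝕋₀
collapse em S x with em {x ≡ bot S}
... | yes _ = ⊥𝕋
... | no _ = ♮

collapse-proper : (em : ExcludedMiddle 0ℓ) (S : BSet) → Proper S 𝕋 (collapse em S)
collapse-proper em S = at-bot , off-bot
  where
  at-bot : collapse em S (bot S) ≡ ⊥𝕋
  at-bot with em {bot S ≡ bot S}
  ... | yes _ = refl
  ... | no ⊥≢⊥ = contradiction refl ⊥≢⊥
  off-bot : ∀ x → x ≢ bot S → collapse em S x ≢ ⊥𝕋
  off-bot x x≢⊥ with em {x ≡ bot S}
  ... | yes x≡⊥ = contradiction x≡⊥ x≢⊥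
  ... | no _ = λ ()

subst-bot : {B : Set} (F : B → BSet) {b c : B} (e : b ≡ c) →
            subst (Car ∘ F) e (bot (F b)) ≡ bot (F c)
subst-bot F refl = refl

subst-reflects-bot : {B : Set} (F : B → BSet) {b c : B} (e : b ≡ c) {x : Car (F b)} →
                     subst (Car ∘ F) e x ≡ bot (F c) → x ≡ bot (F b)
subst-reflects-bot F refl x≡⊥ = x≡⊥

over-not-param : (Λ : Signature) (k : Signature.K Λ) → ¬ IsParam Λ (Signature.over Λ k)
over-not-param Λ k pa = pa (k , refl)

module _ {Λ : Signature} where
  open Signature Λ

  regular-op-injective :
    (X : Alg Λ) → Regular Λ X →
    ∀ {k k′} {v : Args Λ (car X) k} {v′ : Args Λ (car X) k′} (e : over k ≡ over k′) →
    subst (Car ∘ car X) e (op X k v) ≡ op X k′ v′ →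
    op X k′ v′ ≢ ⊥ₐ Λ X (over k′) →
    Σ (k ≡ k′) λ q → subst (Args Λ (car X)) q v ≡ v′
  regular-op-injective X reg {k′ = k′} {v′ = v′} e eq nonbot
    with reg (over k′) (over-not-param Λ k′) (op X k′ v′) nonbot
  ... | _ , _ , _ , _ , unique with unique _ e _ eq | unique k′ refl v′ refl
  ... | refl , refl | refl , refl = refl , refl

module Initiality (em : ExcludedMiddle 0ℓ) (ext : Extensionality 0ℓ 0ℓ)
  {Λ : Signature} (H : HeadType Λ) (V : ParamFamily Λ)
  (X : Alg Λ) (bX : BoundTo Λ V X) (hX : IsHAlg Λ H X)
  (Y : Alg Λ) (bY : BoundTo Λ V Y) (hY : IsHAlg Λ H Y) where
  open Signature Λ

  headX : (b : B) → Car (car X b) → Car (car (alg H) b)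
  headX = Hom.map (proj₁ hX)

  headY : (b : B) → Car (car Y b) → Car (car (alg H) b)
  headY = Hom.map (proj₁ hY)

  data Linked : (b : B) → Car (car X b) → Car (car Y b) → Set where
    bot-linked   : ∀ {b} → Linked b (⊥ₐ Λ X b) (⊥ₐ Λ Y b)
    param-linked : ∀ {b x y} (pa : IsParam Λ b) →
                   cast (bX b pa) x ≡ cast (bY b pa) y → Linked b x y
    op-linked    : ∀ k {v w} → (∀ d → Linked (under k d) (v d) (w d)) →
                   Linked (over k) (op X k v) (op Y k w)

  linked-heads : ∀ {b x y} → Linked b x y → headX b x ≡ headY b y
  linked-heads {b} bot-linked =
    trans (Hom.bottomed (proj₁ hX) b) (sym (Hom.bottomed (proj₁ hY) b))
  linked-heads {b} {x} {y} (param-linked pa eq) = begin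
    headX b x
      ≡⟨ proper-into-𝕋-unique em (isHd H b pa) (proj₂ hX b) properY∘identify x ⟩
    headY b (cast (sym (bY b pa)) (cast (bX b pa) x))
      ≡⟨ cong (headY b) (cast-transpose (bX b pa) (bY b pa) eq) ⟨
    headY b y
      ∎
    where
    open ≡-Reasoning
    properY∘identify : Proper (car X b) (car (alg H) b)
                         (headY b ∘ cast (sym (bY b pa)) ∘ cast (bX b pa))
    properY∘identify =
      ∘-proper (∘-proper (proj₂ hY b) (cast-proper (sym (bY b pa)))) (cast-proper (bX b pa))
  linked-heads (op-linked k {v} {w} vw) = begin
    headX (over k) (op X k v)          ≡⟨ Hom.commutes (proj₁ hX) k v ⟨
    op (alg H) k (λ d → headX _ (v d)) ≡⟨ cong (op (alg H) k) (ext λ d → linked-heads (vw d)) ⟩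
    op (alg H) k (λ d → headY _ (w d)) ≡⟨ Hom.commutes (proj₁ hY) k w ⟩
    headY (over k) (op Y k w)          ∎
    where open ≡-Reasoning

  linked-preserves-bot : ∀ {b x y} → Linked b x y → x ≡ ⊥ₐ Λ X b → y ≡ ⊥ₐ Λ Y b
  linked-preserves-bot {b} {x} {y} xy refl = proper-reflects-bot em (proj₂ hY b) (begin
    headY b y          ≡⟨ linked-heads xy ⟨
    headX b (⊥ₐ Λ X b) ≡⟨ Hom.bottomed (proj₁ hX) b ⟩
    ⊥ₐ Λ (alg H) b     ∎)
    where open ≡-Reasoning

  linked-param : ∀ {b x y} → Linked b x y → (pa : IsParam Λ b) →
                 cast (bX b pa) x ≡ cast (bY b pa) y
  linked-param {b} bot-linked pa =
    trans (proj₁ (cast-proper (bX b pa))) (sym (proj₁ (cast-proper (bY b pa))))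
  linked-param (param-linked _ eq) _ = eq
  linked-param (op-linked k _) pa = contradiction pa (over-not-param Λ k)

  module _ (minX : Minimal Λ X) (regX : Regular Λ X) where

    HasImage : (b : B) → Car (car X b) → Set
    HasImage b x = ∃! _≡_ (Linked b x)

    bot-has-image : ∀ b → HasImage b (⊥ₐ Λ X b)
    bot-has-image b = ⊥ₐ Λ Y b , bot-linked , λ xy → sym (linked-preserves-bot xy refl)

    param-has-image : ∀ a → IsParam Λ a → ∀ x → HasImage a x
    param-has-image a pa x =
      cast (sym (bY a pa)) (cast (bX a pa) x) ,
      param-linked pa (sym (subst-subst-sym (bY a pa))) ,
      λ xy → sym (cast-transpose (bX a pa) (bY a pa) (linked-param xy pa))

    op-has-image : ∀ k (v : Args Λ (car X) k) → (∀ d → HasImage (under k d) (v d)) →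
                   HasImage (over k) (op X k v)
    op-has-image k v images = op Y k w , op-linked k vw , λ xy → invert xy refl refl
      where
      w : Args Λ (car Y) k
      w d = proj₁ (images d)
      vw : ∀ d → Linked (under k d) (v d) (w d)
      vw d = proj₁ (proj₂ (images d))
      -- Inversion at op X k v; the sort is generalised so that Linked can be matched on.
      invert : ∀ {b x y} → Linked b x y → (e : over k ≡ b) →
               subst (Car ∘ car X) e (op X k v) ≡ x → subst (Car ∘ car Y) e (op Y k w) ≡ y
      invert bot-linked refl vx≡⊥ = linked-preserves-bot (op-linked k vw) vx≡⊥
      invert (param-linked pa _) e _ = contradiction (k , e) pa
      invert (op-linked k′ {v′} {w′} vw′) e eq with em {op X k′ v′ ≡ ⊥ₐ Λ X (over k′)}
      ... | yes v′x≡⊥ = begin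
        subst (Car ∘ car Y) e (op Y k w)
          ≡⟨ cong (subst (Car ∘ car Y) e) (linked-preserves-bot (op-linked k vw)
               (subst-reflects-bot (car X) e (trans eq v′x≡⊥))) ⟩
        subst (Car ∘ car Y) e (⊥ₐ Λ Y _)
          ≡⟨ subst-bot (car Y) e ⟩
        ⊥ₐ Λ Y (over k′)
          ≡⟨ linked-preserves-bot (op-linked k′ vw′) v′x≡⊥ ⟨
        op Y k′ w′
          ∎
        where open ≡-Reasoning
      ... | no v′x≢⊥ with regular-op-injective X regX e eq v′x≢⊥
      ... | refl , refl rewrite uip e refl =
        cong (op Y k) (ext λ d → proj₂ (proj₂ (images d)) (vw′ d))

    has-image : ∀ b x → HasImage b x
    has-image = minX HasImage op-has-image bot-has-image param-has-image

    π : Hom Λ X Y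
    π = record
      { map      = λ b x → proj₁ (has-image b x)
      ; bottomed = λ b → proj₂ (proj₂ (has-image b _)) bot-linked
      ; commutes = λ k v → sym (proj₂ (proj₂ (has-image (over k) (op X k v)))
                                  (op-linked k λ d → proj₁ (proj₂ (has-image _ (v d)))))
      }

    π-fixes : Fixes Λ V X Y bX bY π
    π-fixes b pa x = sym (linked-param (proj₁ (proj₂ (has-image b x))) pa)

    fixing-hom-linked : (π′ : Hom Λ X Y) → Fixes Λ V X Y bX bY π′ →
                        ∀ b x → Linked b x (Hom.map π′ b x)
    fixing-hom-linked π′ fixes = minX (λ b x → Linked b x (Hom.map π′ b x))
      (λ k v vπ′v →
         subst (Linked (over k) (op X k v)) (Hom.commutes π′ k v) (op-linked k vπ′v))
      (λ b → subst (Linked b (⊥ₐ Λ X b)) (sym (Hom.bottomed π′ b)) bot-linked)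
      (λ a pa x → param-linked pa (sym (fixes a pa x)))

    π-unique : (π′ : Hom Λ X Y) → Fixes Λ V X Y bX bY π′ →
               ∀ b x → Hom.map π′ b x ≡ Hom.map π b x
    π-unique π′ fixes b x =
      sym (proj₂ (proj₂ (has-image b x)) (fixing-hom-linked π′ fixes b x))

module FreeAlgebra (em : ExcludedMiddle 0ℓ) (ext : Extensionality 0ℓ 0ℓ)
  {Λ : Signature} (H : HeadType Λ) (V : ParamFamily Λ) where
  open Signature Λ

  Hd : B → BSet
  Hd = car (alg H)

  -- Negations are definitionally proof-irrelevant, so the side conditions of ⊥ₜ, par and node
  -- never obstruct equality of terms.
  data Term : B → Set
  head : ∀ {b} → Term b → Car (Hd b)

  data Term where
    ⊥ₜ   : ∀ {b} → ¬ IsParam Λ b → Term b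
    par  : ∀ {b} (pa : IsParam Λ b) → Car (V b pa) → Term b
    node : (k : K) (t : (d : D k) → Term (under k d)) →
           op (alg H) k (λ d → head (t d)) ≢ bot (Hd (over k)) → Term (over k)

  head {b} (⊥ₜ _) = bot (Hd b)
  head {b} (par pa x) = cast (sym (isHd H b pa)) (collapse em (V b pa) x)
  head (node k t _) = op (alg H) k (λ d → head (t d))

  Subterms : K → Set
  Subterms k = (d : D k) → Term (under k d)

  opₜ : (k : K) → Subterms k → Term (over k)
  opₜ k t with em {op (alg H) k (λ d → head (t d)) ≡ bot (Hd (over k))}
  ... | yes _ = ⊥ₜ (over-not-param Λ k)
  ... | no head≢⊥ = node k t head≢⊥

  head-opₜ : ∀ k t → head (opₜ k t) ≡ op (alg H) k (λ d → head (t d))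
  head-opₜ k t with em {op (alg H) k (λ d → head (t d)) ≡ bot (Hd (over k))}
  ... | yes head≡⊥ = sym head≡⊥
  ... | no _ = refl

  opₜ-node : ∀ k t head≢⊥ → opₜ k t ≡ node k t head≢⊥
  opₜ-node k t head≢⊥ with em {op (alg H) k (λ d → head (t d)) ≡ bot (Hd (over k))}
  ... | yes head≡⊥ = contradiction head≡⊥ head≢⊥
  ... | no _ = refl

  root : ∀ {b} → Term b → Maybe (Σ K Subterms)
  root (node k t _) = just (k , t)
  root _ = nothing

  root-opₜ : ∀ k t {r} → root (opₜ k t) ≡ just r → (k , t) ≡ r
  root-opₜ k t eq with em {op (alg H) k (λ d → head (t d)) ≡ bot (Hd (over k))}
  root-opₜ k t () | yes _
  root-opₜ k t eq | no _ = just-injective eq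

  Carrier : (b : B) → Dec (IsParam Λ b) → BSet
  Carrier b (yes pa) = V b pa
  Carrier b (no np) = mkBSet (Term b) (⊥ₜ np)

  toTerm : ∀ {b} δ → Car (Carrier b δ) → Term b
  toTerm (yes pa) x = par pa x
  toTerm (no _) t = t

  fromTerm : ∀ {b} δ → Term b → Car (Carrier b δ)
  fromTerm (yes pa) (⊥ₜ np) = contradiction pa np
  fromTerm (yes _) (par _ x) = x
  fromTerm (yes pa) (node k _ _) = contradiction pa (over-not-param Λ k)
  fromTerm (no _) t = t

  fromTerm-toTerm : ∀ {b} δ (x : Car (Carrier b δ)) → fromTerm δ (toTerm δ x) ≡ x
  fromTerm-toTerm (yes _) x = refl
  fromTerm-toTerm (no _) x = refl

  toTerm-fromTerm : ∀ {b} δ (t : Term b) → toTerm δ (fromTerm δ t) ≡ t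
  toTerm-fromTerm (yes pa) (⊥ₜ np) = contradiction pa np
  toTerm-fromTerm (yes _) (par _ x) = refl
  toTerm-fromTerm (yes pa) (node k _ _) = contradiction pa (over-not-param Λ k)
  toTerm-fromTerm (no _) t = refl

  fromTerm-⊥ₜ : ∀ {b} δ np → fromTerm δ (⊥ₜ np) ≡ bot (Carrier b δ)
  fromTerm-⊥ₜ (yes pa) np = contradiction pa np
  fromTerm-⊥ₜ (no _) _ = refl

  Carrier-param : ∀ {b} δ (pa : IsParam Λ b) → Carrier b δ ≡ V b pa
  Carrier-param (yes _) _ = refl
  Carrier-param (no np) pa = contradiction pa np

  head-proper : ∀ {b} δ → Proper (Carrier b δ) (Hd b) (head ∘ toTerm δ)
  head-proper {b} (yes pa) = ∘-proper (cast-proper (sym (isHd H b pa))) (collapse-proper em (V b pa))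
  head-proper (no np) = refl , head-defined
    where
    head-defined : ∀ t → t ≢ ⊥ₜ np → head t ≢ bot (Hd _)
    head-defined (⊥ₜ _) t≢⊥ = contradiction refl t≢⊥
    head-defined (par pa _) _ = contradiction pa np
    head-defined (node _ _ head≢⊥) _ = head≢⊥

  carrier : B → BSet
  carrier b = Carrier b em

  term : ∀ {b} → Car (carrier b) → Term b
  term = toTerm em

  value : ∀ {b} → Term b → Car (carrier b)
  value = fromTerm em

  free : Alg Λ
  free = record { car = carrier ; op = λ k v → value (opₜ k (λ d → term (v d))) }

  value-node : ∀ k t head≢⊥ → op free k (λ d → value (t d)) ≡ value (node k t head≢⊥)
  value-node k t head≢⊥ = begin
    value (opₜ k (λ d → term (value (t d))))
      ≡⟨ cong (value ∘ opₜ k) (ext λ d → toTerm-fromTerm em (t d)) ⟩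
    value (opₜ k t)
      ≡⟨ cong value (opₜ-node k t head≢⊥) ⟩
    value (node k t head≢⊥)
      ∎
    where open ≡-Reasoning

  root-op : ∀ {k c} {v : Args Λ carrier k} (e : over k ≡ c) {y : Car (carrier c)} →
            subst (Car ∘ carrier) e (op free k v) ≡ y →
            root (opₜ k (λ d → term (v d))) ≡ root (term y)
  root-op {k} {v = v} refl refl = cong root (sym (toTerm-fromTerm em (opₜ k (λ d → term (v d)))))

  bound : BoundTo Λ V free
  bound b = Carrier-param em

  minimal : Minimal Λ free
  minimal Z invariant bottomed params b x =
    subst (Z b) (fromTerm-toTerm em x) (induct (term x))
    where
    induct : ∀ {b} (t : Term b) → Z b (value t)
    induct {b} (⊥ₜ np) = subst (Z b) (sym (fromTerm-⊥ₜ em np)) (bottomed b)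
    induct {b} (par pa x) = params b pa (value (par pa x))
    induct (node k t head≢⊥) =
      subst (Z (over k)) (value-node k t head≢⊥) (invariant k _ (λ d → induct (t d)))

  regular : Regular Λ free
  regular b np x x≢⊥ with term x | fromTerm-toTerm em x
  ... | ⊥ₜ np′ | refl = contradiction (fromTerm-⊥ₜ em np′) x≢⊥
  ... | par pa _ | _ = contradiction pa np
  ... | node k t head≢⊥ | refl =
    k , refl , (λ d → value (t d)) , value-node k t head≢⊥ , unique
    where
    unique : ∀ k′ (e : over k′ ≡ over k) (v′ : Args Λ carrier k′) →
             subst (Car ∘ carrier) e (op free k′ v′) ≡ value (node k t head≢⊥) →
             Σ (k′ ≡ k) λ q → subst (Args Λ carrier) q v′ ≡ (λ d → value (t d))
    unique k′ e v′ eq with Σ-≡,≡←≡ (root-opₜ k′ _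
                            (trans (root-op e eq) (cong root (toTerm-fromTerm em _))))
    ... | refl , terms≡t = refl , ext λ d →
      trans (sym (fromTerm-toTerm em (v′ d))) (cong (λ s → value (s d)) terms≡t)

  head-hom : Hom Λ free (alg H)
  head-hom = record
    { map      = λ b → head ∘ term
    ; bottomed = λ b → proj₁ (head-proper em)
    ; commutes = λ k v → sym (trans (cong head (toTerm-fromTerm em _)) (head-opₜ k _))
    }

  is-H-algebra : IsHAlg Λ H free
  is-H-algebra = head-hom , λ b → head-proper em

proposition3p3p1 :
    ExcludedMiddle 0ℓ → Extensionality 0ℓ 0ℓ →
    (Λ : Signature) (H : HeadType Λ) (V : ParamFamily Λ) →
    Σ (Alg Λ) (λ X → Σ (BoundTo Λ V X) λ _ →
        Minimal Λ X × Regular Λ X × IsHAlg Λ H X)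
    ×
    ((X : Alg Λ) (bX : BoundTo Λ V X) → Minimal Λ X → Regular Λ X →
       IsHAlg Λ H X →
       (Y : Alg Λ) (bY : BoundTo Λ V Y) → IsHAlg Λ H Y →
       Σ (Hom Λ X Y) λ π → Fixes Λ V X Y bX bY π ×
         ((π' : Hom Λ X Y) → Fixes Λ V X Y bX bY π' →
            ∀ b x → Hom.map π' b x ≡ Hom.map π b x))
proposition3p3p1 em ext Λ H V =
  (free , bound , minimal , regular , is-H-algebra) ,
  λ X bX minX regX hX Y bY hY →
    let open Initiality em ext H V X bX hX Y bY hY in
    π minX regX , π-fixes minX regX , π-unique minX regX
  where open FreeAlgebra em ext H V
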